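{- The logic $\mathbf{WWW}$ is strongly complete with respect to the class of all $\mathsf{WWW}$-PN-models, and also with respect to the class of those $\mathsf{WWW}$-PN-models satisfying: for all $w,v\in W$, $X\subseteq W$, if $w\leq v$ and $X\in\mathcal{N}_w$ then $X\in\mathcal{N}_v$. That is, for each of these classes, for every set $\Gamma$ of formulas and formula $\varphi$ with $\Gamma\nvdash_{\mathbf{WWW}}\varphi$, there is a model in the class and a world of it forcing all members of $\Gamma$ but not $\varphi$.
   Context: Formulas are built from a countable set $PV$ of propositional variables and $\bot$ by $\land,\lor,\rightarrow$ and a unary modal operator $\mathsf{W}$; $\lnot\varphi$ abbreviates $\varphi\to\bot$, $\varphi\leftrightarrow\psi$ abbreviates $(\varphi\to\psi)\land(\psi\to\varphi)$. The logic $\mathbf{WWW}$ is the smallest set of formulas containing all instances of the axiom schemes of intuitionistic propositional logic and all instances of $\mathsf{W}\varphi\to\lnot\varphi$, closed under modus ponens, the rule "from $\varphi\leftrightarrow\psi$ infer $\mathsf{W}\varphi\leftrightarrow\mathsf{W}\psi$", and the rule "from $\varphi\to\psi$ infer $(\mathsf{W}\varphi\land\lnot\psi)\to\mathsf{W}\psi$". $\Gamma\vdash_{\mathbf{WWW}}\varphi$ means there are $\gamma_1,\dots,\gamma_n\in\Gamma$ ($n\ge0$) with $(\gamma_1\land\dots\land\gamma_n)\to\varphi\in\mathbf{WWW}$. A $\mathsf{WWW}$-PN-model is a quadruple $\langle W,\mathcal{N},\leq,V\rangle$ with $\leq$ a partial order on $W$, $\mathcal{N}:W\to P(P(W))$,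 $V:PV\to P(W)$ with each $V(q)$ upward closed, such that (i) if $w\leq v$, $X\in\mathcal{N}_w$ and $v\notin X$ then $X\in\mathcal{N}_v$; and (ii) if $X\in\mathcal{N}_w$ and $X\subseteq Y\subseteq W$ then $Y\in\mathcal{N}_w$. Forcing: $w\nVdash\bot$; $w\Vdash q$ iff $w\in V(q)$; $\land,\lor$ pointwise; $w\Vdash\varphi\to\psi$ iff for all $v\geq w$, $v\nVdash\varphi$ or $v\Vdash\psi$; $w\Vdash\mathsf{W}\varphi$ iff $w\Vdash\lnot\varphi$ and $V(\varphi)\in\mathcal{N}_w$, where $V(\varphi)=\{z:z\Vdash\varphi\}$. -}

module Defs where

open import Level using (Level; _⊔_; Setω) renaming (suc to lsuc; zero to lzero)
open import Data.Nat using (ℕ)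
open import Data.Empty using (⊥)
open import Data.List using (List; []; _∷_)
open import Data.List.Relation.Unary.All using (All)
open import Data.Product using (Σ; _×_; ∃)
open import Data.Sum using (_⊎_)
open import Relation.Nullary using (¬_)
open import Relation.Binary.PropositionalEquality using (_≡_)

infixr 6 _∧_
infixr 5 _∨_
infixr 4 _⇒_
infix 2 _⊢_

data Formula : Set where
  var : ℕ → Formula
  ⊥'  : Formula
  _∧_ : Formula → Formula → Formula
  _∨_ : Formula → Formula → Formula
  _⇒_ : Formula → Formula → Formula
  𝖶   : Formula → Formula

∼_ : Formula → Formula
∼ φ = φ ⇒ ⊥'

_⇔_ : Formula → Formula → Formula
φ ⇔ ψ = (φ ⇒ ψ) ∧ (ψ ⇒ φ)

⊤' : Formula
⊤' = ⊥' ⇒ ⊥'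

data WWW : Formula → Set where
  ax-K   : ∀ φ ψ → WWW (φ ⇒ ψ ⇒ φ)
  ax-S   : ∀ φ ψ χ → WWW ((φ ⇒ ψ ⇒ χ) ⇒ (φ ⇒ ψ) ⇒ φ ⇒ χ)
  ax-∧E₁ : ∀ φ ψ → WWW (φ ∧ ψ ⇒ φ)
  ax-∧E₂ : ∀ φ ψ → WWW (φ ∧ ψ ⇒ ψ)
  ax-∧I  : ∀ φ ψ → WWW (φ ⇒ ψ ⇒ φ ∧ ψ)
  ax-∨I₁ : ∀ φ ψ → WWW (φ ⇒ φ ∨ ψ)
  ax-∨I₂ : ∀ φ ψ → WWW (ψ ⇒ φ ∨ ψ)
  ax-∨E  : ∀ φ ψ χ → WWW ((φ ⇒ χ) ⇒ (ψ ⇒ χ) ⇒ φ ∨ ψ ⇒ χ)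
  ax-⊥E  : ∀ φ → WWW (⊥' ⇒ φ)
  ax-W   : ∀ φ → WWW (𝖶 φ ⇒ ∼ φ)
  mp     : ∀ {φ ψ} → WWW (φ ⇒ ψ) → WWW φ → WWW ψ
  re-W   : ∀ {φ ψ} → WWW (φ ⇔ ψ) → WWW (𝖶 φ ⇔ 𝖶 ψ)
  mono-W : ∀ {φ ψ} → WWW (φ ⇒ ψ) → WWW ((𝖶 φ ∧ ∼ ψ) ⇒ 𝖶 ψ)

⋀ : List Formula → Formula
⋀ []           = ⊤'
⋀ (γ ∷ [])     = γ
⋀ (γ ∷ δ ∷ γs) = γ ∧ ⋀ (δ ∷ γs)

FormulaSet : Set₁
FormulaSet = Formula → Set

_⊢_ : FormulaSet → Formula → Set
Γ ⊢ φ = Σ (List Formula) λ γs → All Γ γs × WWW (⋀ γs ⇒ φ)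

record PNModel (ℓ : Level) : Set (lsuc ℓ) where
  field
    W       : Set ℓ
    _≤_     : W → W → Set ℓ
    ≤-refl  : ∀ {w} → w ≤ w
    ≤-trans : ∀ {u v w} → u ≤ v → v ≤ w → u ≤ w
    ≤-antisym : ∀ {u v} → u ≤ v → v ≤ u → u ≡ v
    𝒩       : W → (W → Set ℓ) → Set ℓ
    V       : ℕ → W → Set ℓ
    V-up    : ∀ q {w v} → w ≤ v → V q w → V q v
    𝒩-pers  : ∀ {w v} (X : W → Set ℓ) → w ≤ v → 𝒩 w X → ¬ X v → 𝒩 v X
    𝒩-mono  : ∀ {w} (X Y : W → Set ℓ) → 𝒩 w X → (∀ z → X z → Y z) → 𝒩 w Y

module _ {ℓ : Level} (M : PNModel ℓ) where
  open PNModel M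

  _⊩_ : W → Formula → Set ℓ
  w ⊩ var q   = V q w
  w ⊩ ⊥'      = Level.Lift ℓ ⊥
  w ⊩ (φ ∧ ψ) = (w ⊩ φ) × (w ⊩ ψ)
  w ⊩ (φ ∨ ψ) = (w ⊩ φ) ⊎ (w ⊩ ψ)
  w ⊩ (φ ⇒ ψ) = ∀ v → w ≤ v → v ⊩ φ → v ⊩ ψ
  w ⊩ 𝖶 φ     = (∀ v → w ≤ v → v ⊩ φ → v ⊩ ⊥') × 𝒩 w (λ z → z ⊩ φ)

Upward𝒩 : ∀ {ℓ} → PNModel ℓ → Set (lsuc ℓ)
Upward𝒩 M = ∀ {w v} (X : W → Set _) → w ≤ v → 𝒩 w X → 𝒩 v X
  where open PNModel M

StronglyComplete : (PNModel (lsuc lzero) → Set₂) → Set₂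
StronglyComplete C =
  ∀ (Γ : FormulaSet) (φ : Formula) → ¬ (Γ ⊢ φ) →
    Σ (PNModel (lsuc lzero)) λ M → C M × Σ (PNModel.W M) λ w →
      (∀ γ → Γ γ → _⊩_ M w γ) × ¬ (_⊩_ M w φ)

ExcludedMiddle : Setω
ExcludedMiddle = ∀ {ℓ} (P : Set ℓ) → P ⊎ ¬ P

AllPNModels : PNModel (lsuc lzero) → Set₂
AllPNModels _ = Level.Lift (lsuc (lsuc lzero)) Data.Unit.⊤
  where import Data.Unit

UpwardPNModels : PNModel (lsuc lzero) → Set₂
UpwardPNModels M = Upward𝒩 M

-- The canonical model is made of prime theories: deductively closed,
-- consistent sets Γ with α ∨ β ∈ Γ only if α ∈ Γ or β ∈ Γ, ordered by
-- inclusion.  A theory T has as neighbourhoods the supersets of the truth sets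
-- ‖χ‖ = {U | χ ∈ U} of the χ with 𝖶 χ ∈ T.  Classically, every unprovable
-- sequent extends to a prime theory (Lindenbaum), which gives the truth lemma
-- for → as in intuitionistic logic.  For 𝖶 ψ, a neighbourhood ‖χ‖ ⊆ ‖ψ‖
-- forces ⊢ χ → ψ by Lindenbaum again, and the monotonicity rule turns 𝖶 χ and
-- ¬ ψ into 𝖶 ψ.  Since neighbourhoods only depend on which 𝖶 χ belong to a
-- theory, they are inherited by larger theories, so the canonical model lies in
-- both classes.
module Submission where

open import Defs
open import Level using (Lift; lift; lower) renaming (suc to lsuc; zero to lzero)
open import Data.Nat using (ℕ; zero; suc; _≤_; _≤′_; ≤′-refl; ≤′-step; _⊔_)
open import Data.Nat.Properties using (≤⇒≤′; m≤m⊔n; m≤n⊔m)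
open import Data.List using (List; []; _∷_; _++_; map; cartesianProductWith)
open import Data.List.Membership.Propositional using (_∈_)
open import Data.List.Membership.Propositional.Properties
  using (∈-++⁺ˡ; ∈-++⁺ʳ; ∈-map⁺; ∈-cartesianProductWith⁺)
open import Data.List.Relation.Binary.Subset.Propositional using () renaming (_⊆_ to _⊆ₗ_)
open import Data.List.Relation.Unary.All as All using (All; []; _∷_)
open import Data.List.Relation.Unary.All.Properties using (++⁺)
open import Data.List.Relation.Unary.Any using (here; there)
open import Data.Product using (Σ; ∃; _×_; _,_; proj₁; proj₂)
open import Data.Sum using (_⊎_; inj₁; inj₂; [_,_]; map₂)
open import Data.Empty using (⊥-elim)
open import Data.Unit using (tt)
open import Relation.Nullary using (¬_)
open import Relation.Unary using (Pred; _⊆_; _∪_; ｛_｝; ∅)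
open import Relation.Binary.PropositionalEquality using (_≡_; refl; trans)

private
  variable
    α β φ χ ψ : Formula
    γs δs : List Formula
    A B : FormulaSet

⊢-id : ∀ α → WWW (α ⇒ α)
⊢-id α = mp (mp (ax-S α (α ⇒ α) α) (ax-K α (α ⇒ α))) (ax-K α α)

infix 3 _⊢ₗ_

data _⊢ₗ_ (Γ : List Formula) : Formula → Set where
  hyp : φ ∈ Γ → Γ ⊢ₗ φ
  thm : WWW φ → Γ ⊢ₗ φ
  app : Γ ⊢ₗ (φ ⇒ ψ) → Γ ⊢ₗ φ → Γ ⊢ₗ ψ

⊢ₗ-closed : [] ⊢ₗ φ → WWW φ
⊢ₗ-closed (thm p)   = p
⊢ₗ-closed (app d e) = mp (⊢ₗ-closed d) (⊢ₗ-closed e)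

deduction : (α ∷ γs) ⊢ₗ β → γs ⊢ₗ (α ⇒ β)
deduction {α} (hyp (here refl))   = thm (⊢-id α)
deduction {α} (hyp {β} (there p)) = app (thm (ax-K β α)) (hyp p)
deduction {α} (thm {β} p)         = app (thm (ax-K β α)) (thm p)
deduction {α} (app {χ} {β} d e)   = app (app (thm (ax-S α χ β)) (deduction d)) (deduction e)

⊢ₗ-subst : (∀ {χ} → χ ∈ γs → δs ⊢ₗ χ) → γs ⊢ₗ φ → δs ⊢ₗ φ
⊢ₗ-subst σ (hyp p)   = σ p
⊢ₗ-subst σ (thm p)   = thm p
⊢ₗ-subst σ (app d e) = app (⊢ₗ-subst σ d) (⊢ₗ-subst σ e)

⊢ₗ-weaken : γs ⊆ₗ δs → γs ⊢ₗ φ → δs ⊢ₗ φ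
⊢ₗ-weaken γs⊆δs = ⊢ₗ-subst (λ p → hyp (γs⊆δs p))

⋀-elim : ∀ γs → χ ∈ γs → (⋀ γs ∷ []) ⊢ₗ χ
⋀-elim (γ ∷ [])     (here refl) = hyp (here refl)
⋀-elim (γ ∷ δ ∷ γs) (here refl) = app (thm (ax-∧E₁ γ (⋀ (δ ∷ γs)))) (hyp (here refl))
⋀-elim (γ ∷ δ ∷ γs) (there p)   = ⊢ₗ-subst rest (⋀-elim (δ ∷ γs) p)
  where
  rest : ∀ {χ} → χ ∈ ⋀ (δ ∷ γs) ∷ [] → (⋀ (γ ∷ δ ∷ γs) ∷ []) ⊢ₗ χ
  rest (here refl) = app (thm (ax-∧E₂ γ (⋀ (δ ∷ γs)))) (hyp (here refl))

⊢ₗ⇒⋀⇒ : γs ⊢ₗ φ → WWW (⋀ γs ⇒ φ)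
⊢ₗ⇒⋀⇒ {γs} d = ⊢ₗ-closed (deduction (⊢ₗ-subst (⋀-elim γs) d))

infix 2 _⊢ₛ_

_⊢ₛ_ : FormulaSet → Formula → Set
A ⊢ₛ φ = Σ (List Formula) λ γs → All A γs × γs ⊢ₗ φ

⊢ₛ⇒⊢ : A ⊢ₛ φ → A ⊢ φ
⊢ₛ⇒⊢ (γs , γs∈A , d) = γs , γs∈A , ⊢ₗ⇒⋀⇒ d

∅⊢ₛ⇒WWW : ∅ ⊢ₛ φ → WWW φ
∅⊢ₛ⇒WWW ([] , [] , d) = ⊢ₗ-closed d

⊢ₛ-hyp : A φ → A ⊢ₛ φ
⊢ₛ-hyp {φ = φ} a = φ ∷ [] , a ∷ [] , hyp (here refl)

⊢ₛ-thm : WWW φ → A ⊢ₛ φ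
⊢ₛ-thm p = [] , [] , thm p

⊢ₛ-mp : A ⊢ₛ (φ ⇒ ψ) → A ⊢ₛ φ → A ⊢ₛ ψ
⊢ₛ-mp (γs , γs∈A , d) (δs , δs∈A , e) =
  γs ++ δs , ++⁺ γs∈A δs∈A , app (⊢ₗ-weaken ∈-++⁺ˡ d) (⊢ₗ-weaken (∈-++⁺ʳ γs) e)

⊢ₛ-mono : A ⊆ B → A ⊢ₛ φ → B ⊢ₛ φ
⊢ₛ-mono A⊆B (γs , γs∈A , d) = γs , All.map A⊆B γs∈A , d

All-∪-split : ∀ γs → All (｛ α ｝ ∪ A) γs → ∃ λ δs → All A δs × γs ⊆ₗ α ∷ δs
All-∪-split []       []                 = [] , [] , λ ()
All-∪-split (γ ∷ γs) (γ∈α∪A ∷ γs∈α∪A) with All-∪-split γs γs∈α∪A | γ∈α∪A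
... | δs , δs∈A , γs⊆α∷δs | inj₁ refl = δs , δs∈A , λ { (here refl) → here refl ; (there p) → γs⊆α∷δs p }
... | δs , δs∈A , γs⊆α∷δs | inj₂ γ∈A  = γ ∷ δs , γ∈A ∷ δs∈A , γ∷γs⊆α∷γ∷δs
  where
  γ∷γs⊆α∷γ∷δs : γ ∷ γs ⊆ₗ _ ∷ γ ∷ δs
  γ∷γs⊆α∷γ∷δs (here refl) = there (here refl)
  γ∷γs⊆α∷γ∷δs (there p) with γs⊆α∷δs p
  ... | here refl = here refl
  ... | there q   = there (there q)

⊢ₛ-deduction : ｛ α ｝ ∪ A ⊢ₛ β → A ⊢ₛ (α ⇒ β)
⊢ₛ-deduction (γs , γs∈α∪A , d) with All-∪-split γs γs∈α∪A
... | δs , δs∈A , γs⊆α∷δs = δs , δs∈A , deduction (⊢ₗ-weaken γs⊆α∷δs d)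

module _ {a ℓ} {I : Set a} (P : ℕ → Pred I ℓ) (grow : ∀ n → P n ⊆ P (suc n)) where

  cumulative-mono : ∀ {m n} → m ≤ n → P m ⊆ P n
  cumulative-mono m≤n = go (≤⇒≤′ m≤n)
    where
    go : ∀ {m n} → m ≤′ n → P m ⊆ P n
    go ≤′-refl       = λ x → x
    go (≤′-step m≤n) = λ x → grow _ (go m≤n x)

  cumulative-All : ∀ {xs} → All (λ x → ∃ λ n → P n x) xs → ∃ λ n → All (P n) xs
  cumulative-All []                 = zero , []
  cumulative-All ((m , p) ∷ ps) with cumulative-All ps
  ... | n , qs = m ⊔ n , cumulative-mono (m≤m⊔n m n) p ∷ All.map (cumulative-mono (m≤n⊔m m n)) qs

connectives : List Formula → List Formula
connectives F =
  cartesianProductWith _∧_ F F ++ cartesianProductWith _∨_ F F ++ cartesianProductWith _⇒_ F F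

formulasUpTo : ℕ → List Formula
formulasUpTo zero    = ⊥' ∷ []
formulasUpTo (suc n) = formulasUpTo n ++ var n ∷ map 𝖶 (formulasUpTo n) ++ connectives (formulasUpTo n)

formulasUpTo-grow : ∀ n → (_∈ formulasUpTo n) ⊆ (_∈ formulasUpTo (suc n))
formulasUpTo-grow n = ∈-++⁺ˡ

module _ {F : List Formula} {α β : Formula} (α∈F : α ∈ F) (β∈F : β ∈ F) where

  ∧-∈-connectives : α ∧ β ∈ connectives F
  ∧-∈-connectives = ∈-++⁺ˡ (∈-cartesianProductWith⁺ _∧_ α∈F β∈F)

  ∨-∈-connectives : α ∨ β ∈ connectives F
  ∨-∈-connectives = ∈-++⁺ʳ (cartesianProductWith _∧_ F F) (∈-++⁺ˡ (∈-cartesianProductWith⁺ _∨_ α∈F β∈F))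

  ⇒-∈-connectives : (α ⇒ β) ∈ connectives F
  ⇒-∈-connectives = ∈-++⁺ʳ (cartesianProductWith _∧_ F F)
    (∈-++⁺ʳ (cartesianProductWith _∨_ F F) (∈-cartesianProductWith⁺ _⇒_ α∈F β∈F))

module _ {n : ℕ} where

  var-∈-formulasUpTo : var n ∈ formulasUpTo (suc n)
  var-∈-formulasUpTo = ∈-++⁺ʳ (formulasUpTo n) (here refl)

  𝖶-∈-formulasUpTo : φ ∈ formulasUpTo n → 𝖶 φ ∈ formulasUpTo (suc n)
  𝖶-∈-formulasUpTo φ∈ = ∈-++⁺ʳ (formulasUpTo n) (there (∈-++⁺ˡ (∈-map⁺ 𝖶 φ∈)))

  connective-∈-formulasUpTo : φ ∈ connectives (formulasUpTo n) → φ ∈ formulasUpTo (suc n)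
  connective-∈-formulasUpTo φ∈ =
    ∈-++⁺ʳ (formulasUpTo n) (there (∈-++⁺ʳ (map 𝖶 (formulasUpTo n)) φ∈))

enumerate : ∀ φ → ∃ λ n → φ ∈ formulasUpTo n
enumerate₂ : ∀ α β → ∃ λ n → α ∈ formulasUpTo n × β ∈ formulasUpTo n

enumerate₂ α β with enumerate α | enumerate β
... | m , α∈ | n , β∈ =
  m ⊔ n , cumulative-mono (λ k → _∈ formulasUpTo k) formulasUpTo-grow (m≤m⊔n m n) α∈
        , cumulative-mono (λ k → _∈ formulasUpTo k) formulasUpTo-grow (m≤n⊔m m n) β∈

enumerate (var q) = suc q , var-∈-formulasUpTo
enumerate ⊥'      = zero , here refl
enumerate (𝖶 φ) with enumerate φ
... | n , φ∈ = suc n , 𝖶-∈-formulasUpTo φ∈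
enumerate (α ∧ β) with enumerate₂ α β
... | n , α∈ , β∈ = suc n , connective-∈-formulasUpTo (∧-∈-connectives α∈ β∈)
enumerate (α ∨ β) with enumerate₂ α β
... | n , α∈ , β∈ = suc n , connective-∈-formulasUpTo (∨-∈-connectives α∈ β∈)
enumerate (α ⇒ β) with enumerate₂ α β
... | n , α∈ , β∈ = suc n , connective-∈-formulasUpTo (⇒-∈-connectives α∈ β∈)

record PrimeTheory : Set₁ where
  field
    formulas   : FormulaSet
    closed     : ∀ {χ} → formulas ⊢ₛ χ → formulas χ
    consistent : ¬ formulas ⊥'
    prime      : ∀ {α β} → formulas (α ∨ β) → formulas α ⊎ formulas β

open PrimeTheory

infix 4 _∋_ _≼_

_∋_ : PrimeTheory → Formula → Set
T ∋ φ = formulas T φ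

∋-mp : ∀ T → T ∋ (α ⇒ β) → T ∋ α → T ∋ β
∋-mp T α⇒β∈T α∈T = closed T (⊢ₛ-mp (⊢ₛ-hyp α⇒β∈T) (⊢ₛ-hyp α∈T))

∋-thm : ∀ T → WWW φ → T ∋ φ
∋-thm T p = closed T (⊢ₛ-thm p)

∋-by₁ : ∀ T → WWW (α ⇒ β) → T ∋ α → T ∋ β
∋-by₁ T p = ∋-mp T (∋-thm T p)

∋-by₂ : ∀ T → WWW (α ⇒ β ⇒ χ) → T ∋ α → T ∋ β → T ∋ χ
∋-by₂ T p α∈T = ∋-mp T (∋-by₁ T p α∈T)

-- Inclusion alone is not antisymmetric on records without extensionality, so
-- T ≼ U also asks that the reverse inclusion force T ≡ U; this holds both for
-- T itself and for any U that is not included in T.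
_≼_ : PrimeTheory → PrimeTheory → Set₁
T ≼ U = Lift (lsuc lzero) (formulas T ⊆ formulas U) × (formulas U ⊆ formulas T → T ≡ U)

≼⇒⊆ : ∀ {T U} → T ≼ U → formulas T ⊆ formulas U
≼⇒⊆ T≼U = lower (proj₁ T≼U)

≼-refl : ∀ {T} → T ≼ T
≼-refl = lift (λ x → x) , λ _ → refl

≼-trans : ∀ {T U V} → T ≼ U → U ≼ V → T ≼ V
≼-trans (lift T⊆U , T≡U) (lift U⊆V , U≡V) =
  lift (λ x → U⊆V (T⊆U x)) , λ V⊆T → trans (T≡U (λ x → V⊆T (U⊆V x))) (U≡V (λ x → T⊆U (V⊆T x)))

𝒩ᶜ : PrimeTheory → (PrimeTheory → Set₁) → Set₁
𝒩ᶜ T X = Σ Formula λ χ → Lift (lsuc lzero) (T ∋ 𝖶 χ) × (∀ U → U ∋ χ → X U)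

𝒩ᶜ-up : ∀ {T U} {X : PrimeTheory → Set₁} → T ≼ U → 𝒩ᶜ T X → 𝒩ᶜ U X
𝒩ᶜ-up T≼U (χ , lift 𝖶χ∈T , ‖χ‖⊆X) = χ , lift (≼⇒⊆ T≼U 𝖶χ∈T) , ‖χ‖⊆X

canonical : PNModel _
canonical = record
  { W         = PrimeTheory
  ; _≤_       = _≼_
  ; ≤-refl    = ≼-refl
  ; ≤-trans   = ≼-trans
  ; ≤-antisym = λ T≼U U≼T → proj₂ T≼U (≼⇒⊆ U≼T)
  ; 𝒩         = 𝒩ᶜ
  ; V         = λ q T → Lift (lsuc lzero) (T ∋ var q)
  ; V-up      = λ q T≼U q∈T → lift (≼⇒⊆ T≼U (lower q∈T))
  ; 𝒩-pers    = λ X T≼U X∈𝒩T _ → 𝒩ᶜ-up T≼U X∈𝒩T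
  ; 𝒩-mono    = λ { X Y (χ , 𝖶χ∈T , ‖χ‖⊆X) X⊆Y → χ , 𝖶χ∈T , λ U χ∈U → X⊆Y U (‖χ‖⊆X U χ∈U) }
  }

canonical-upward : Upward𝒩 canonical
canonical-upward X = 𝒩ᶜ-up

module _ (lem : ExcludedMiddle) where

  module Lindenbaum (Δ : FormulaSet) (φ : Formula) (Δ⊬φ : ¬ (Δ ⊢ₛ φ)) where

    addIfConsistent : Formula → FormulaSet → FormulaSet
    addIfConsistent ψ D = D ∪ λ χ → ψ ≡ χ × ¬ (｛ ψ ｝ ∪ D ⊢ₛ φ)

    addAll : List Formula → FormulaSet → FormulaSet
    addAll []      D = D
    addAll (ψ ∷ L) D = addAll L (addIfConsistent ψ D)

    stage : ℕ → FormulaSet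
    stage zero    = Δ
    stage (suc n) = addAll (formulasUpTo n) (stage n)

    limit : FormulaSet
    limit χ = ∃ λ n → stage n χ

    addIfConsistent-⊬ : ∀ {D} ψ → ¬ (D ⊢ₛ φ) → ¬ (addIfConsistent ψ D ⊢ₛ φ)
    addIfConsistent-⊬ {D} ψ D⊬φ ψD⊢φ = D⊬φ (⊢ₛ-mono only-D ψD⊢φ)
      where
      only-D : addIfConsistent ψ D ⊆ D
      only-D (inj₁ χ∈D)      = χ∈D
      only-D (inj₂ (_ , ψ⊬)) = ⊥-elim (ψ⊬ (⊢ₛ-mono [ inj₂ , (λ { (ψ≡χ , _) → inj₁ ψ≡χ }) ] ψD⊢φ))

    addAll-⊬ : ∀ {D} L → ¬ (D ⊢ₛ φ) → ¬ (addAll L D ⊢ₛ φ)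
    addAll-⊬ []      D⊬φ = D⊬φ
    addAll-⊬ (ψ ∷ L) D⊬φ = addAll-⊬ L (addIfConsistent-⊬ ψ D⊬φ)

    addAll-⊇ : ∀ {D} L → D ⊆ addAll L D
    addAll-⊇ []      = λ x → x
    addAll-⊇ (ψ ∷ L) = λ x → addAll-⊇ L (inj₁ x)

    addAll-decides : ∀ D L {ψ} → ψ ∈ L →
      addAll L D ψ ⊎ ∃ λ D′ → D′ ⊆ addAll L D × (｛ ψ ｝ ∪ D′ ⊢ₛ φ)
    addAll-decides D (ψ ∷ L) (here refl) with lem (｛ ψ ｝ ∪ D ⊢ₛ φ)
    ... | inj₁ ψD⊢φ = inj₂ (D , (λ x → addAll-⊇ L (inj₁ x)) , ψD⊢φ)
    ... | inj₂ ψD⊬φ = inj₁ (addAll-⊇ L (inj₂ (refl , ψD⊬φ)))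
    addAll-decides D (_ ∷ L) (there p) = addAll-decides (addIfConsistent _ D) L p

    stage-⊬ : ∀ n → ¬ (stage n ⊢ₛ φ)
    stage-⊬ zero    = Δ⊬φ
    stage-⊬ (suc n) = addAll-⊬ (formulasUpTo n) (stage-⊬ n)

    limit-⊬ : ¬ (limit ⊢ₛ φ)
    limit-⊬ (γs , γs∈limit , d) with cumulative-All stage (λ n → addAll-⊇ (formulasUpTo n)) γs∈limit
    ... | n , γs∈stage = stage-⊬ n (γs , γs∈stage , d)

    limit-maximal : ¬ limit ψ → ｛ ψ ｝ ∪ limit ⊢ₛ φ
    limit-maximal {ψ} ψ∉limit with enumerate ψ
    ... | n , ψ∈ with addAll-decides (stage n) (formulasUpTo n) ψ∈
    ... | inj₁ ψ∈stage            = ⊥-elim (ψ∉limit (suc n , ψ∈stage))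
    ... | inj₂ (D′ , D′⊆ , ψD′⊢φ) = ⊢ₛ-mono (map₂ λ x → suc n , D′⊆ x) ψD′⊢φ

    limit-closed : limit ⊢ₛ χ → limit χ
    limit-closed {χ} limit⊢χ with lem (limit χ)
    ... | inj₁ χ∈limit = χ∈limit
    ... | inj₂ χ∉limit = ⊥-elim (limit-⊬ (⊢ₛ-mp (⊢ₛ-deduction (limit-maximal χ∉limit)) limit⊢χ))

    limit-prime : limit (α ∨ β) → limit α ⊎ limit β
    limit-prime {α} {β} α∨β∈limit with lem (limit α) | lem (limit β)
    ... | inj₁ α∈limit | _            = inj₁ α∈limit
    ... | _            | inj₁ β∈limit = inj₂ β∈limit
    ... | inj₂ α∉limit | inj₂ β∉limit = ⊥-elim (limit-⊬
      (⊢ₛ-mp (⊢ₛ-mp (⊢ₛ-mp (⊢ₛ-thm (ax-∨E α β φ))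
        (⊢ₛ-deduction (limit-maximal α∉limit))) (⊢ₛ-deduction (limit-maximal β∉limit)))
        (⊢ₛ-hyp α∨β∈limit)))

    theory : PrimeTheory
    theory = record
      { formulas   = limit
      ; closed     = limit-closed
      ; consistent = λ ⊥∈limit → limit-⊬ (⊢ₛ-mp (⊢ₛ-thm (ax-⊥E φ)) (⊢ₛ-hyp ⊥∈limit))
      ; prime      = limit-prime
      }

  lindenbaum : ∀ Δ φ → ¬ (Δ ⊢ₛ φ) → Σ PrimeTheory λ T → Δ ⊆ formulas T × ¬ (T ∋ φ)
  lindenbaum Δ φ Δ⊬φ = theory , (λ δ → zero , δ) , (λ φ∈limit → limit-⊬ (⊢ₛ-hyp φ∈limit))
    where open Lindenbaum Δ φ Δ⊬φ

  ⇒-counterexample : ∀ T → ¬ (T ∋ (α ⇒ β)) → Σ PrimeTheory λ U → T ≼ U × U ∋ α × ¬ (U ∋ β)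
  ⇒-counterexample {α} {β} T α⇒β∉T
    with lindenbaum (｛ α ｝ ∪ formulas T) β (λ αT⊢β → α⇒β∉T (closed T (⊢ₛ-deduction αT⊢β)))
  ... | U , αT⊆U , β∉U with lem (formulas U ⊆ formulas T)
  ... | inj₁ U⊆T = T , ≼-refl , U⊆T (αT⊆U (inj₁ refl)) , λ β∈T → β∉U (αT⊆U (inj₂ β∈T))
  ... | inj₂ U⊈T = U , (lift (λ x → αT⊆U (inj₂ x)) , λ U⊆T → ⊥-elim (U⊈T U⊆T)) , αT⊆U (inj₁ refl) , β∉U

  ∋-⇒-intro : ∀ T → (∀ U → T ≼ U → U ∋ α → U ∋ β) → T ∋ (α ⇒ β)
  ∋-⇒-intro {α} {β} T α⊆β with lem (T ∋ (α ⇒ β))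
  ... | inj₁ α⇒β∈T = α⇒β∈T
  ... | inj₂ α⇒β∉T with ⇒-counterexample T α⇒β∉T
  ... | U , T≼U , α∈U , β∉U = ⊥-elim (β∉U (α⊆β U T≼U α∈U))

  ‖‖-⊆⇒⊢ : (∀ U → U ∋ χ → U ∋ ψ) → WWW (χ ⇒ ψ)
  ‖‖-⊆⇒⊢ {χ} {ψ} ‖χ‖⊆‖ψ‖ with lem (WWW (χ ⇒ ψ))
  ... | inj₁ ⊢χ⇒ψ = ⊢χ⇒ψ
  ... | inj₂ ⊬χ⇒ψ with lindenbaum (｛ χ ｝ ∪ ∅) ψ (λ χ⊢ψ → ⊬χ⇒ψ (∅⊢ₛ⇒WWW (⊢ₛ-deduction χ⊢ψ)))
  ... | U , χ⊆U , ψ∉U = ⊥-elim (ψ∉U (‖χ‖⊆‖ψ‖ U (χ⊆U (inj₁ refl))))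

  infix 4 _⊩ᶜ_

  _⊩ᶜ_ : PrimeTheory → Formula → Set₁
  _⊩ᶜ_ = _⊩_ canonical

  ⊩ᶜ⇒∋ : ∀ φ {T} → T ⊩ᶜ φ → T ∋ φ
  ∋⇒⊩ᶜ : ∀ φ {T} → T ∋ φ → T ⊩ᶜ φ

  ⊩ᶜ⇒∋ (var q) (lift q∈T)             = q∈T
  ⊩ᶜ⇒∋ ⊥' (lift ())
  ⊩ᶜ⇒∋ (α ∧ β) {T} (⊩α , ⊩β)          = ∋-by₂ T (ax-∧I α β) (⊩ᶜ⇒∋ α ⊩α) (⊩ᶜ⇒∋ β ⊩β)
  ⊩ᶜ⇒∋ (α ∨ β) {T} (inj₁ ⊩α)          = ∋-by₁ T (ax-∨I₁ α β) (⊩ᶜ⇒∋ α ⊩α)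
  ⊩ᶜ⇒∋ (α ∨ β) {T} (inj₂ ⊩β)          = ∋-by₁ T (ax-∨I₂ α β) (⊩ᶜ⇒∋ β ⊩β)
  ⊩ᶜ⇒∋ (α ⇒ β) {T} ⊩α⇒β               =
    ∋-⇒-intro T λ U T≼U α∈U → ⊩ᶜ⇒∋ β (⊩α⇒β U T≼U (∋⇒⊩ᶜ α α∈U))
  ⊩ᶜ⇒∋ (𝖶 ψ) {T} (⊩∼ψ , χ , lift 𝖶χ∈T , ‖χ‖⊆‖ψ‖) =
    ∋-by₁ T (mono-W (‖‖-⊆⇒⊢ λ U χ∈U → ⊩ᶜ⇒∋ ψ (‖χ‖⊆‖ψ‖ U χ∈U)))
      (∋-by₂ T (ax-∧I (𝖶 χ) (∼ ψ)) 𝖶χ∈T ∼ψ∈T)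
    where
    ∼ψ∈T : T ∋ ∼ ψ
    ∼ψ∈T = ∋-⇒-intro T λ U T≼U ψ∈U → ⊥-elim (lower (⊩∼ψ U T≼U (∋⇒⊩ᶜ ψ ψ∈U)))

  ∋⇒⊩ᶜ (var q) q∈T                     = lift q∈T
  ∋⇒⊩ᶜ ⊥' {T} ⊥∈T                      = ⊥-elim (consistent T ⊥∈T)
  ∋⇒⊩ᶜ (α ∧ β) {T} α∧β∈T               =
    ∋⇒⊩ᶜ α (∋-by₁ T (ax-∧E₁ α β) α∧β∈T) , ∋⇒⊩ᶜ β (∋-by₁ T (ax-∧E₂ α β) α∧β∈T)
  ∋⇒⊩ᶜ (α ∨ β) {T} α∨β∈T with prime T α∨β∈T
  ... | inj₁ α∈T = inj₁ (∋⇒⊩ᶜ α α∈T)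
  ... | inj₂ β∈T = inj₂ (∋⇒⊩ᶜ β β∈T)
  ∋⇒⊩ᶜ (α ⇒ β) α⇒β∈T U T≼U ⊩α         = ∋⇒⊩ᶜ β (∋-mp U (≼⇒⊆ T≼U α⇒β∈T) (⊩ᶜ⇒∋ α ⊩α))
  ∋⇒⊩ᶜ (𝖶 ψ) 𝖶ψ∈T                      = ⊩∼ψ , ψ , lift 𝖶ψ∈T , λ U → ∋⇒⊩ᶜ ψ
    where
    ⊩∼ψ : ∀ U → _ ≼ U → U ⊩ᶜ ψ → U ⊩ᶜ ⊥'
    ⊩∼ψ U T≼U ⊩ψ = ⊥-elim (consistent U
      (∋-mp U (∋-by₁ U (ax-W ψ) (≼⇒⊆ T≼U 𝖶ψ∈T)) (⊩ᶜ⇒∋ ψ ⊩ψ)))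

  completeness : ∀ {C : PNModel _ → Set₂} → C canonical → StronglyComplete C
  completeness C-canonical Γ φ Γ⊬φ with lindenbaum Γ φ (λ Γ⊢ₛφ → Γ⊬φ (⊢ₛ⇒⊢ Γ⊢ₛφ))
  ... | T , Γ⊆T , φ∉T =
    canonical , C-canonical , T , (λ γ γ∈Γ → ∋⇒⊩ᶜ γ (Γ⊆T γ∈Γ)) , (λ ⊩φ → φ∉T (⊩ᶜ⇒∋ φ ⊩φ))

mainTheorem10 : ExcludedMiddle →
    StronglyComplete AllPNModels × StronglyComplete UpwardPNModels
mainTheorem10 lem = completeness lem (lift tt) , completeness lem (λ {T} {U} → canonical-upward {T} {U})
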